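{- Let $s$ and $n\ge2$ be positive integers, $0\le k\le n$, let $d\ge3$ be a divisor of $2s(n-1)+2$ and $\omega$ a primitive $d$-th root of unity. Then $[F(s,n,k;q)]_{q=\omega}$ equals: $\binom{\frac{s(n-1)+1+k}{d}-1}{\frac{k}{d}}\left[\binom{\frac{n}{d}}{\frac{k}{d}}+\binom{\frac{n}{d}-1}{\frac{k}{d}-1}\right]$ if $d$ is odd, $d|k$, $d|n$; $\binom{\frac{s(n-1)+1+k}{d}-1}{\frac{k}{d}}\binom{\lfloor\frac{n-2}{d}\rfloor}{\frac{k}{d}}$ if $d$ is odd, $d|k$, $d\nmid n$; $\binom{\frac{2s(n-1)+2+2k}{d}-1}{\frac{2k}{d}}\left[\binom{\frac{2n}{d}}{\frac{2k}{d}}+\binom{\frac{2n}{d}-1}{\frac{2k}{d}-1}\right]$ if $d\ge4$ is even, $d|2k$, $d|n$; $\binom{\frac{2s(n-1)+2+2k}{d}-1}{\frac{2k}{d}}\binom{\lfloor\frac{2(n-2)}{d}\rfloor}{\frac{2k}{d}}$ if $d\ge4$ is even, $d|2k$, $d\nmid n$; and $0$ otherwise.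
   Context: $F(s,n,k;q)={s(n-1)+k\brack k}_{q^2}{n-1\brack k}_{q^2}+{s(n-1)+k\brack k}_{q^2}{n-2\brack k-1}_{q^2}q^n+{s(n-1)+k\brack k}_{q^2}{n-2\brack k-2}_{q^2}+{s(n-1)+k-1\brack k}_{q^2}{n-2\brack k-2}_{q^2}q^n$, where ${m\brack i}_{q^2}$ is the Gaussian binomial coefficient ${m\brack i}_q=\frac{[m]!_q}{[i]!_q[m-i]!_q}$ (zero if $i<0$ or $i>m$) with $q$ replaced by $q^2$, $[m]_q=1+\cdots+q^{m-1}$. Ordinary binomials $\binom{a}{b}$ vanish for $b<0$ or $b>a$. -}

module Defs where

open import Level using (Level)
open import Data.Nat using (ℕ; zero; suc; _∸_; _<_)
import Data.Nat as N
open import Data.Product using (Σ; _×_)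
open import Relation.Nullary using (¬_)
open import Algebra.Bundles using (CommutativeRing; Semiring)
open import Data.Nat.Combinatorics using (_C_)
import Algebra.Definitions.RawSemiring as RS

module _ {c ℓ : Level} (R : CommutativeRing c ℓ) where
  open CommutativeRing R
  open RS (Semiring.rawSemiring semiring) using (_^_) renaming (_×_ to _·ℕ_)

  IsFieldR : Set (c Level.⊔ ℓ)
  IsFieldR = (¬ (1# ≈ 0#)) × (∀ a → ¬ (a ≈ 0#) → Σ Carrier λ b → (a * b) ≈ 1#)

  CharZero : Set ℓ
  CharZero = ∀ m → ¬ ((suc m ·ℕ 1#) ≈ 0#)

  PrimitiveRoot : ℕ → Carrier → Set ℓ
  PrimitiveRoot d ω = ((ω ^ d) ≈ 1#) × (∀ j → 0 < j → j < d → ¬ ((ω ^ j) ≈ 1#))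

  gbin : Carrier → ℕ → ℕ → Carrier
  gbin x m zero = 1#
  gbin x zero (suc i) = 0#
  gbin x (suc m) (suc i) = gbin x m i + (x ^ suc i) * gbin x m (suc i)

  -- gbinSub x m k j = [m brack k - j]_x, which is 0 when k < j (negative lower index)
  gbinSub : Carrier → ℕ → ℕ → ℕ → Carrier
  gbinSub x m k zero = gbin x m k
  gbinSub x m zero (suc j) = 0#
  gbinSub x m (suc k) (suc j) = gbinSub x m k j

  F : ℕ → ℕ → ℕ → Carrier → Carrier
  F s n k q =
      gbin q2 (s N.* (n ∸ 1) N.+ k) k * gbin q2 (n ∸ 1) k
    + gbin q2 (s N.* (n ∸ 1) N.+ k) k * gbinSub q2 (n ∸ 2) k 1 * (q ^ n)
    + gbin q2 (s N.* (n ∸ 1) N.+ k) k * gbinSub q2 (n ∸ 2) k 2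
    + gbin q2 (s N.* (n ∸ 1) N.+ k ∸ 1) k * gbinSub q2 (n ∸ 2) k 2 * (q ^ n)
    where q2 = q * q

-- ordinary binomial with lower index a - j (zero if a < j)
binomSub : ℕ → ℕ → ℕ → ℕ
binomSub m a zero = m C a
binomSub m zero (suc j) = 0
binomSub m (suc a) (suc j) = binomSub m a j

module _ {c ℓ : Level} (R : CommutativeRing c ℓ) where
  open CommutativeRing R
  open RS (Semiring.rawSemiring semiring) using () renaming (_×_ to _·ℕ_)

  ι : ℕ → Carrier
  ι m = m ·ℕ 1#

-- Put x = ω², a primitive e-th root of unity with e = d for odd d and e = d/2 for even d.
-- Comparing the two q-Pascal rules gives [e, i]ₓ = 0 for 0 < i < e, hence
-- [m + e, i]ₓ = [m, i]ₓ + [m, i - e]ₓ, which iterates to the q-Lucas theorem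
-- [r + a e, t + b e]ₓ = (a choose b) [r, t]ₓ for base-e digits r, t < e.
-- The hypothesis d ∣ 2s(n-1) + 2 says s(n-1) ≡ -1 (mod e); this fixes the last digit of every
-- upper index in F.  So F vanishes unless e ∣ k, and for k = K e, writing s(n-1) + 1 = (N+1) e
-- and n - 2 = v + u e,
--   F = (N+K choose K) ((u choose K) + (u choose K-1) [v, e-2]ₓ (1 + ωⁿ)),
-- where [v, e-2]ₓ is 1 if e ∣ n and 0 otherwise, and 1 + ωⁿ is 2 if d ∣ n and 0 if e ∣ n, d ∤ n.

module Submission where

open import Defs
open import Level using (Level)
open import Data.Nat as ℕ using (ℕ; zero; suc; _∸_; _≤_; _<_; z≤n; s≤s; NonZero)
import Data.Nat.Properties as ℕₚ
open import Data.Nat.DivMod using (_/_; _divMod_; result; m*n/n≡m; m<n⇒m/n≡0; +-distrib-/-∣ʳ)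
open import Data.Nat.Divisibility using (_∣_; _∣?_; divides; divides-refl; ∣⇒≤; ∣m+n∣m⇒∣n; n∣m*n; *-cancelʳ-∣; ∣-trans)
open import Data.Nat.Coprimality using (Coprime; coprime-divisor)
open import Data.Nat.Primality using (irreducible[2])
open import Data.Nat.Combinatorics using (_C_; nCk+nC[k+1]≡[n+1]C[k+1])
open import Data.Nat.Tactic.RingSolver using (solve-∀)
open import Data.Fin using (zero; suc; toℕ)
open import Data.Fin.Properties using (toℕ<n)
open import Data.Product using (∃; ∃₂; _×_; _,_; proj₁; proj₂)
open import Data.Sum using (inj₁; inj₂)
open import Relation.Nullary using (¬_; yes; no; contradiction)
open import Relation.Binary.PropositionalEquality as ≡ using (_≡_; refl)
open import Algebra.Bundles using (CommutativeRing; Semiring)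
import Algebra.Definitions.RawSemiring as RS

module _ where
  open import Data.Nat using (_+_; _*_)

  [r+q*e]/e≡q : ∀ q {r e} .{{_ : NonZero e}} → r < e → (r + q * e) / e ≡ q
  [r+q*e]/e≡q q {r} {e} r<e = begin
    (r + q * e) / e      ≡⟨ +-distrib-/-∣ʳ r (divides-refl q) ⟩
    r / e + q * e / e    ≡⟨ ≡.cong₂ _+_ (m<n⇒m/n≡0 r<e) (m*n/n≡m q e) ⟩
    q                    ∎
    where open ≡.≡-Reasoning

  e∤r+q*e : ∀ q {r e} → 0 < r → r < e → ¬ e ∣ r + q * e
  e∤r+q*e q {suc r} {e} _ r<e e∣ =
    ℕₚ.<⇒≱ r<e (∣⇒≤ (∣m+n∣m⇒∣n (≡.subst (e ∣_) (ℕₚ.+-comm (suc r) (q * e)) e∣) (n∣m*n q)))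

  suc-C≡C+binomSub : ∀ u K → suc u C K ≡ u C K + binomSub u K 1
  suc-C≡C+binomSub u zero    = refl
  suc-C≡C+binomSub u (suc K) = ≡.trans (≡.sym (nCk+nC[k+1]≡[n+1]C[k+1] u K)) (ℕₚ.+-comm (u C K) _)

  odd⇒coprime-2 : ∀ {d} → ¬ 2 ∣ d → Coprime d 2
  odd⇒coprime-2 ¬2∣d (c∣d , c∣2) with irreducible[2] c∣2
  ... | inj₁ c≡1 = c≡1
  ... | inj₂ refl = contradiction c∣d ¬2∣d

  -- e ∣ s (m + 1) + 1 rules out e ∣ m + 1, so the last base-e digit of m is not e - 1.
  last-digit≤ : ∀ {f s m N} → s * suc m ≡ suc f + N * suc (suc f) →
                ∃₂ λ v u → v ≤ f × m ≡ v + u * suc (suc f)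
  last-digit≤ {f} {s} {m} {N} S≡ with m divMod suc (suc f)
  ... | result u v m≡ with ℕₚ.m≤n⇒m<n∨m≡n (ℕₚ.≤-pred (toℕ<n v))
  ...   | inj₁ v<1+f = toℕ v , u , ℕₚ.≤-pred v<1+f , m≡
  ...   | inj₂ v≡1+f = contradiction (≡.subst (suc (suc f) ∣_) S≡ e∣S) (e∤r+q*e N (s≤s z≤n) ℕₚ.≤-refl)
    where
      e∣S : suc (suc f) ∣ s * suc m
      e∣S = ∣-trans (divides (suc u) (≡.trans (≡.cong suc m≡) (≡.cong (λ w → suc (w + u * suc (suc f))) v≡1+f)))
                    (n∣m*n s)

  ∣2+m⇒last-digit : ∀ {f m} → suc (suc f) ∣ suc (suc m) → ∃ λ u → m ≡ f + u * suc (suc f)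
  ∣2+m⇒last-digit (divides (suc u) eq) = u , ℕₚ.suc-injective (ℕₚ.suc-injective eq)

  j+j≡j*2 : ∀ j → j + j ≡ j * 2
  j+j≡j*2 = solve-∀

  x+[y+z]≡x+z+y : ∀ x y z → x + (y + z) ≡ x + z + y
  x+[y+z]≡x+z+y = solve-∀

  x+[y+z]≡y+[x+z] : ∀ x y z → x + (y + z) ≡ y + (x + z)
  x+[y+z]≡y+[x+z] = solve-∀

  S+k≡t+[N+K+1]e : ∀ f N t K → suc f + N * suc (suc f) + (suc t + K * suc (suc f)) ≡ t + suc (N + K) * suc (suc f)
  S+k≡t+[N+K+1]e = solve-∀

  S+1+Ke≡[N+K+1]e : ∀ f N K → suc f + N * suc (suc f) + 1 + K * suc (suc f) ≡ suc (N + K) * suc (suc f)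
  S+1+Ke≡[N+K+1]e = solve-∀

  2S+2+2Ke≡[N+K+1][2e] : ∀ f N K → 2 * (suc f + N * suc (suc f)) + 2 + 2 * (K * suc (suc f))
                                    ≡ suc (N + K) * (suc (suc f) * 2)
  2S+2+2Ke≡[N+K+1][2e] = solve-∀

  2[Ke]≡K[e2] : ∀ K e → 2 * (K * e) ≡ K * (e * 2)
  2[Ke]≡K[e2] = solve-∀

  2sm+2≡2[sm+1] : ∀ s m → 2 * s * m + 2 ≡ 2 * (s * m + 1)
  2sm+2≡2[sm+1] = solve-∀

  2sm+2≡[sm+1]2 : ∀ s m → 2 * s * m + 2 ≡ (s * m + 1) * 2
  2sm+2≡[sm+1]2 = solve-∀

  odd∣2[S+1]⇒∣S+1 : ∀ {d s m} → ¬ 2 ∣ d → d ∣ 2 * s * m + 2 → d ∣ s * m + 1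
  odd∣2[S+1]⇒∣S+1 {d} {s} {m} d-odd d∣ = coprime-divisor (odd⇒coprime-2 d-odd) (≡.subst (d ∣_) (2sm+2≡2[sm+1] s m) d∣)

  2e∣2[S+1]⇒e∣S+1 : ∀ {e s m} → e * 2 ∣ 2 * s * m + 2 → e ∣ s * m + 1
  2e∣2[S+1]⇒e∣S+1 {e} {s} {m} 2e∣ = *-cancelʳ-∣ 2 (≡.subst (e * 2 ∣_) (2sm+2≡[sm+1]2 s m) 2e∣)

  [2[v+ue]]/[e2]≡u : ∀ u {v e} .{{_ : NonZero e}} .{{_ : NonZero (e * 2)}} → v < e → (2 * (v + u * e)) / (e * 2) ≡ u
  [2[v+ue]]/[e2]≡u u {v} {e} v<e = ≡.trans (≡.cong (_/ (e * 2)) 2[v+ue]≡) ([r+q*e]/e≡q u 2v<2e)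
    where
      2[v+ue]≡ : 2 * (v + u * e) ≡ 2 * v + u * (e * 2)
      2[v+ue]≡ = ≡.trans (ℕₚ.*-distribˡ-+ 2 v (u * e)) (≡.cong (2 * v +_) (2[Ke]≡K[e2] u e))
      2v<2e : 2 * v < e * 2
      2v<2e = ≡.subst (2 * v <_) (ℕₚ.*-comm 2 e) (ℕₚ.*-monoʳ-< 2 v<e)

  ∣S+1⇒S≡ : ∀ {f S} → suc (suc f) ∣ S + 1 → ∃ λ N → S ≡ suc f + N * suc (suc f)
  ∣S+1⇒S≡ {S = S} (divides zero eq)    = contradiction (≡.trans (ℕₚ.+-comm 1 S) eq) λ ()
  ∣S+1⇒S≡ {S = S} (divides (suc N) eq) = N , ℕₚ.suc-injective (≡.trans (ℕₚ.+-comm 1 S) eq)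

module GaussianBinomial {c ℓ : Level} (R : CommutativeRing c ℓ) (x : CommutativeRing.Carrier R) where
  open CommutativeRing R renaming (refl to ≈-refl)
  open RS (Semiring.rawSemiring semiring) using (_^_)
  open import Relation.Binary.Reasoning.Setoid setoid
  open import Algebra.Solver.Ring.NaturalCoefficients.Default commutativeSemiring

  private
    G : ℕ → ℕ → Carrier
    G = gbin R x

  gbin-over : ∀ {m i} → m < i → G m i ≈ 0#
  gbin-over {zero}  {suc i} _          = ≈-refl
  gbin-over {suc m} {suc i} (s≤s m<i) = begin
    G m i + x ^ suc i * G m (suc i) ≈⟨ +-cong (gbin-over m<i) (*-congˡ (gbin-over (ℕₚ.m<n⇒m<1+n m<i))) ⟩
    0# + x ^ suc i * 0#             ≈⟨ trans (+-identityˡ _) (zeroʳ _) ⟩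
    0#                              ∎

  gbin-diag : ∀ m → G m m ≈ 1#
  gbin-diag zero    = ≈-refl
  gbin-diag (suc m) = begin
    G m m + x ^ suc m * G m (suc m) ≈⟨ +-cong (gbin-diag m) (*-congˡ (gbin-over (ℕₚ.n<1+n m))) ⟩
    1# + x ^ suc m * 0#             ≈⟨ trans (+-congˡ (zeroʳ _)) (+-identityʳ 1#) ⟩
    1#                              ∎

  gbin-suc-1 : ∀ m → G (suc m) 1 ≈ x ^ m + G m 1
  gbin-suc-1 zero    = +-congˡ (zeroʳ _)
  gbin-suc-1 (suc m) = begin
    1# + x ^ 1 * G (suc m) 1           ≈⟨ +-congˡ (*-congˡ (gbin-suc-1 m)) ⟩
    1# + x ^ 1 * (x ^ m + G m 1)       ≈⟨ solve 3 (λ x p g → con 1 :+ x :* con 1 :* (p :+ g) := x :* p :+ (con 1 :+ x :* con 1 :* g))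
                                                  ≈-refl x (x ^ m) (G m 1) ⟩
    x ^ suc m + (1# + x ^ 1 * G m 1)   ∎

  gbin-pascalʳ : ∀ a i {m} → a ℕ.+ i ≡ m → G (suc m) (suc i) ≈ x ^ a * G m i + G m (suc i)
  gbin-pascalʳ zero i refl = begin
    G i i + x ^ suc i * G i (suc i) ≈⟨ +-cong (gbin-diag i) (*-congˡ (gbin-over (ℕₚ.n<1+n i))) ⟩
    1# + x ^ suc i * 0#             ≈⟨ solve 1 (λ y → con 1 :+ y :* con 0 := con 1 :* con 1 :+ con 0) ≈-refl (x ^ suc i) ⟩
    1# * 1# + 0#                    ≈⟨ sym (+-cong (*-congˡ (gbin-diag i)) (gbin-over (ℕₚ.n<1+n i))) ⟩
    x ^ 0 * G i i + G i (suc i)     ∎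
  gbin-pascalʳ (suc a) zero refl rewrite ℕₚ.+-identityʳ a = begin
    G (suc (suc a)) 1                 ≈⟨ gbin-suc-1 (suc a) ⟩
    x ^ suc a + G (suc a) 1           ≈⟨ +-congʳ (sym (*-identityʳ _)) ⟩
    x ^ suc a * 1# + G (suc a) 1      ∎
  gbin-pascalʳ (suc a) (suc i) refl = begin
    P′ + x ^ suc (suc i) * T′
      ≈⟨ +-cong (gbin-pascalʳ (suc a) i (≡.sym (ℕₚ.+-suc a i))) (*-congˡ (gbin-pascalʳ a (suc i) refl)) ⟩
    (x ^ suc a * P + Q) + x ^ suc (suc i) * (x ^ a * Q + T)
      ≈⟨ solve 6 (λ x xa xi P Q T → (x :* xa :* P :+ Q) :+ x :* (x :* xi) :* (xa :* Q :+ T)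
                                    := x :* xa :* (P :+ x :* xi :* Q) :+ (Q :+ x :* (x :* xi) :* T))
               ≈-refl x (x ^ a) (x ^ i) P Q T ⟩
    x ^ suc a * (P + x ^ suc i * Q) + (Q + x ^ suc (suc i) * T) ∎
    where
      M : ℕ
      M = a ℕ.+ suc i
      P Q T P′ T′ : Carrier
      P = G M i
      Q = G M (suc i)
      T = G M (suc (suc i))
      P′ = G (suc M) (suc i)
      T′ = G (suc M) (suc (suc i))

  gbinSub-< : ∀ {m i j} → i < j → gbinSub R x m i j ≡ 0#
  gbinSub-< {i = zero}  {suc j} _         = refl
  gbinSub-< {i = suc i} {suc j} (s≤s i<j) = gbinSub-< i<j

  gbinSub-+ : ∀ m j i → gbinSub R x m (j ℕ.+ i) j ≡ G m i
  gbinSub-+ m zero    i = refl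
  gbinSub-+ m (suc j) i = gbinSub-+ m j i

  gbinSub-diag : ∀ m j → gbinSub R x m j j ≡ 1#
  gbinSub-diag m zero    = refl
  gbinSub-diag m (suc j) = gbinSub-diag m j

  gbinSub-pascal : ∀ m i j → gbinSub R x m i j + x ^ (suc i ∸ j) * gbinSub R x m (suc i) j ≈ gbinSub R x (suc m) (suc i) j
  gbinSub-pascal m i       zero          = ≈-refl
  gbinSub-pascal m zero    (suc zero)    = trans (+-identityˡ _) (*-identityˡ 1#)
  gbinSub-pascal m zero    (suc (suc j)) = trans (+-identityˡ _) (zeroʳ _)
  gbinSub-pascal m (suc i) (suc j)       = gbinSub-pascal m i j

module PrimitiveRoots {c ℓ : Level} (R : CommutativeRing c ℓ) where
  open CommutativeRing R renaming (refl to ≈-refl)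
  open RS (Semiring.rawSemiring semiring) using (_^_)
  open import Relation.Binary.Reasoning.Setoid setoid
  open import Algebra.Properties.Semiring.Exp semiring using (^-congˡ; ^-congʳ; ^-homo-*; ^-assocʳ)
  open import Algebra.Properties.CommutativeSemiring.Exp commutativeSemiring using (^-distrib-*)

  1^n≈1 : ∀ n → 1# ^ n ≈ 1#
  1^n≈1 zero    = ≈-refl
  1^n≈1 (suc n) = trans (*-identityˡ _) (1^n≈1 n)

  ^-multiple≈1 : ∀ {ω d} q → ω ^ d ≈ 1# → ω ^ (q ℕ.* d) ≈ 1#
  ^-multiple≈1 {ω} {d} q ωᵈ≈1 = begin
    ω ^ (q ℕ.* d)  ≈⟨ ^-congʳ ω (ℕₚ.*-comm q d) ⟩
    ω ^ (d ℕ.* q)  ≈⟨ sym (^-assocʳ ω d q) ⟩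
    (ω ^ d) ^ q    ≈⟨ ^-congˡ q ωᵈ≈1 ⟩
    1# ^ q         ≈⟨ 1^n≈1 q ⟩
    1#             ∎

  ∣⇒^≈1 : ∀ {ω d n} → PrimitiveRoot R d ω → d ∣ n → ω ^ n ≈ 1#
  ∣⇒^≈1 (ωᵈ≈1 , _) (divides q refl) = ^-multiple≈1 q ωᵈ≈1

  ^≈1⇒∣ : ∀ {ω d n} .{{_ : NonZero d}} → PrimitiveRoot R d ω → ω ^ n ≈ 1# → d ∣ n
  ^≈1⇒∣ {ω} {d} {n} (ωᵈ≈1 , minimal) ωⁿ≈1 with n divMod d
  ... | result q zero    n≡ = divides q n≡
  ... | result q (suc r) n≡ = contradiction ωʳ≈1 (minimal (suc (toℕ r)) (s≤s z≤n) (toℕ<n (suc r)))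
    where
      ωʳ≈1 : ω ^ suc (toℕ r) ≈ 1#
      ωʳ≈1 = begin
        ω ^ suc (toℕ r)                   ≈⟨ sym (*-identityʳ _) ⟩
        ω ^ suc (toℕ r) * 1#              ≈⟨ *-congˡ (sym (^-multiple≈1 q ωᵈ≈1)) ⟩
        ω ^ suc (toℕ r) * ω ^ (q ℕ.* d)   ≈⟨ sym (^-homo-* ω (suc (toℕ r)) (q ℕ.* d)) ⟩
        ω ^ (suc (toℕ r) ℕ.+ q ℕ.* d)     ≈⟨ ^-congʳ ω (≡.sym n≡) ⟩
        ω ^ n                             ≈⟨ ωⁿ≈1 ⟩
        1#                                ∎

  square^ : ∀ ω j → (ω * ω) ^ j ≈ ω ^ (j ℕ.+ j)
  square^ ω j = trans (^-distrib-* ω ω j) (sym (^-homo-* ω j j))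

  square-primitive-odd : ∀ {d ω} .{{_ : NonZero d}} → ¬ 2 ∣ d → PrimitiveRoot R d ω → PrimitiveRoot R d (ω * ω)
  square-primitive-odd {d} {ω} d-odd prim@(ωᵈ≈1 , _) = xᵈ≈1 , minimal
    where
      xᵈ≈1 : (ω * ω) ^ d ≈ 1#
      xᵈ≈1 = trans (^-distrib-* ω ω d) (trans (*-cong ωᵈ≈1 ωᵈ≈1) (*-identityˡ 1#))
      minimal : ∀ j → 0 < j → j < d → ¬ (ω * ω) ^ j ≈ 1#
      minimal (suc j) _ j<d xʲ≈1 = ℕₚ.<⇒≱ j<d (∣⇒≤ (coprime-divisor (odd⇒coprime-2 d-odd) d∣2j))
        where
          d∣2j : d ∣ 2 ℕ.* suc j
          d∣2j = ≡.subst (d ∣_) (≡.trans (j+j≡j*2 (suc j)) (ℕₚ.*-comm (suc j) 2))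
                         (^≈1⇒∣ prim (trans (sym (square^ ω (suc j))) xʲ≈1))

  square-primitive-even : ∀ {e ω} .{{_ : NonZero e}} → PrimitiveRoot R (e ℕ.* 2) ω → PrimitiveRoot R e (ω * ω)
  square-primitive-even {e} {ω} prim@(ω²ᵉ≈1 , _) = xᵉ≈1 , minimal
    where
      xᵉ≈1 : (ω * ω) ^ e ≈ 1#
      xᵉ≈1 = trans (square^ ω e) (trans (^-congʳ ω (j+j≡j*2 e)) ω²ᵉ≈1)
      minimal : ∀ j → 0 < j → j < e → ¬ (ω * ω) ^ j ≈ 1#
      minimal (suc j) _ j<e xʲ≈1 = ℕₚ.<⇒≱ j<e (∣⇒≤ (*-cancelʳ-∣ 2 e*2∣j*2))
        where
          e*2∣j*2 : e ℕ.* 2 ∣ suc j ℕ.* 2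
          e*2∣j*2 = ≡.subst (e ℕ.* 2 ∣_) (j+j≡j*2 (suc j))
                            (^≈1⇒∣ {{ℕₚ.m*n≢0 e 2}} prim (trans (sym (square^ ω (suc j))) xʲ≈1))

module Field {c ℓ : Level} (R : CommutativeRing c ℓ) (isField : IsFieldR R) where
  open CommutativeRing R renaming (refl to ≈-refl)
  open RS (Semiring.rawSemiring semiring) using (_^_)
  open import Relation.Binary.Reasoning.Setoid setoid
  open import Algebra.Properties.Semiring.Exp semiring using (^-homo-*)
  open import Algebra.Properties.Group +-group using (x∙y⁻¹≈ε⇒x≈y)
  open import Algebra.Properties.Ring ring using (-‿distribˡ-*)
  open PrimitiveRoots R

  ≉0∧*≈0⇒≈0 : ∀ {a b} → ¬ a ≈ 0# → a * b ≈ 0# → b ≈ 0#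
  ≉0∧*≈0⇒≈0 {a} {b} a≉0 ab≈0 with proj₂ isField a a≉0
  ... | a⁻¹ , aa⁻¹≈1 = begin
    b              ≈⟨ sym (*-identityˡ b) ⟩
    1# * b         ≈⟨ *-congʳ (sym aa⁻¹≈1) ⟩
    (a * a⁻¹) * b  ≈⟨ trans (*-congʳ (*-comm a a⁻¹)) (*-assoc a⁻¹ a b) ⟩
    a⁻¹ * (a * b)  ≈⟨ *-congˡ ab≈0 ⟩
    a⁻¹ * 0#       ≈⟨ zeroʳ a⁻¹ ⟩
    0#             ∎

  fixed≈0 : ∀ {y g} → ¬ y ≈ 1# → y * g ≈ g → g ≈ 0#
  fixed≈0 {y} {g} y≉1 yg≈g = ≉0∧*≈0⇒≈0 1-y≉0 (begin
    (1# - y) * g      ≈⟨ distribʳ g 1# (- y) ⟩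
    1# * g + - y * g  ≈⟨ +-cong (*-identityˡ g) (sym (-‿distribˡ-* y g)) ⟩
    g + - (y * g)     ≈⟨ +-congˡ (-‿cong yg≈g) ⟩
    g - g             ≈⟨ -‿inverseʳ g ⟩
    0#                ∎)
    where
      1-y≉0 : ¬ (1# - y) ≈ 0#
      1-y≉0 1-y≈0 = y≉1 (sym (x∙y⁻¹≈ε⇒x≈y 1# y 1-y≈0))

  square≈1⇒1+z≈0 : ∀ {z} → z * z ≈ 1# → ¬ z ≈ 1# → 1# + z ≈ 0#
  square≈1⇒1+z≈0 {z} z²≈1 z≉1 = fixed≈0 z≉1 (begin
    z * (1# + z)    ≈⟨ distribˡ z 1# z ⟩
    z * 1# + z * z  ≈⟨ +-cong (*-identityʳ z) z²≈1 ⟩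
    z + 1#          ≈⟨ +-comm z 1# ⟩
    1# + z          ∎)

  half-order-power≈-1 : ∀ {e ω n} .{{_ : NonZero e}} → PrimitiveRoot R (e ℕ.* 2) ω →
                        e ∣ n → ¬ e ℕ.* 2 ∣ n → 1# + ω ^ n ≈ 0#
  half-order-power≈-1 {e} {ω} {n} prim (divides q n≡qe) 2e∤n =
    square≈1⇒1+z≈0 (trans (sym (^-homo-* ω n n)) (∣⇒^≈1 prim (divides q n+n≡q*2e)))
                   (λ ωⁿ≈1 → 2e∤n (^≈1⇒∣ {{ℕₚ.m*n≢0 e 2}} prim ωⁿ≈1))
    where
      n+n≡q*2e : n ℕ.+ n ≡ q ℕ.* (e ℕ.* 2)
      n+n≡q*2e = ≡.trans (j+j≡j*2 n) (≡.trans (≡.cong (ℕ._* 2) n≡qe) (ℕₚ.*-assoc q e 2))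

module QLucas {c ℓ : Level} (R : CommutativeRing c ℓ) (isField : IsFieldR R)
              (e : ℕ) .{{_ : NonZero e}} (x : CommutativeRing.Carrier R) (prim : PrimitiveRoot R e x) where
  open CommutativeRing R renaming (refl to ≈-refl)
  open RS (Semiring.rawSemiring semiring) using (_^_)
  open import Relation.Binary.Reasoning.Setoid setoid
  open import Algebra.Solver.Ring.NaturalCoefficients.Default commutativeSemiring
  open import Algebra.Properties.Semiring.Exp semiring using (^-congʳ; ^-homo-*)
  open import Algebra.Properties.Semiring.Mult semiring using (×-homo-+)
  open import Algebra.Properties.Group +-group using () renaming (∙-cancelˡ to +-cancelˡ)
  open import Relation.Binary.Definitions using (tri<; tri≈; tri>)
  open GaussianBinomial R x
  open Field R isField using (fixed≈0)

  private
    G : ℕ → ℕ → Carrier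
    G = gbin R x
    Gₑ : ℕ → ℕ → Carrier
    Gₑ m i = gbinSub R x m i e
    xᵉ≈1 : x ^ e ≈ 1#
    xᵉ≈1 = proj₁ prim
    0<e : 0 < e
    0<e = ℕ.>-nonZero⁻¹ e

  gbin-root≈0 : ∀ {i} → 0 < i → i < e → G e i ≈ 0#
  gbin-root≈0 {suc i} _ = vanish i
    where
      -- once x^a [e, i] = [e, i], the two q-Pascal rules at [e+1, i+1] force x^(i+1) [e, i+1] = [e, i+1]
      step : ∀ a i → a ℕ.+ i ≡ e → x ^ a * G e i ≈ G e i → suc i < e → G e (suc i) ≈ 0#
      step a i a+i≡e fixed i+1<e = fixed≈0 (proj₂ prim (suc i) (s≤s z≤n) i+1<e)
        (+-cancelˡ (G e i) _ _ (trans (gbin-pascalʳ a i a+i≡e) (+-congʳ fixed)))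
      vanish : ∀ i → suc i < e → G e (suc i) ≈ 0#
      vanish zero    1<e   = step e 0 (ℕₚ.+-identityʳ e) (trans (*-identityʳ _) xᵉ≈1) 1<e
      vanish (suc i) i+2<e = step (e ∸ suc i) (suc i) (ℕₚ.m∸n+n≡m (ℕₚ.<⇒≤ i+1<e))
        (trans (*-congˡ [e,i+1]≈0) (trans (zeroʳ _) (sym [e,i+1]≈0))) i+2<e
        where
          i+1<e : suc i < e
          i+1<e = ℕₚ.<-trans (ℕₚ.n<1+n (suc i)) i+2<e
          [e,i+1]≈0 : G e (suc i) ≈ 0#
          [e,i+1]≈0 = vanish i i+1<e

  x^-periodic : ∀ m i → x ^ i * Gₑ m i ≈ x ^ (i ∸ e) * Gₑ m i
  x^-periodic m i with ℕₚ.<-≤-connex i e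
  ... | inj₁ i<e rewrite gbinSub-< {m} i<e = trans (zeroʳ _) (sym (zeroʳ _))
  ... | inj₂ e≤i = *-congʳ (begin
    x ^ i                   ≈⟨ ^-congʳ x (≡.sym (ℕₚ.m+[n∸m]≡n e≤i)) ⟩
    x ^ (e ℕ.+ (i ∸ e))     ≈⟨ ^-homo-* x e (i ∸ e) ⟩
    x ^ e * x ^ (i ∸ e)     ≈⟨ trans (*-congʳ xᵉ≈1) (*-identityˡ _) ⟩
    x ^ (i ∸ e)             ∎)

  -- q-Vandermonde with one factor [e, j]: only j = 0 and j = e survive
  gbin-+e : ∀ m i → G (m ℕ.+ e) i ≈ G m i + Gₑ m i
  gbin-+e zero zero = sym (trans (+-congˡ (reflexive (gbinSub-< 0<e))) (+-identityʳ 1#))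
  gbin-+e zero (suc i) with ℕₚ.<-cmp (suc i) e
  ... | tri< i+1<e _ _ = trans (gbin-root≈0 (s≤s z≤n) i+1<e) (sym (trans (+-identityˡ _) (reflexive (gbinSub-< i+1<e))))
  ... | tri≈ _ refl _ = trans (gbin-diag (suc i)) (sym (trans (+-identityˡ _) (reflexive (gbinSub-diag 0 (suc i)))))
  ... | tri> _ _ e<i+1 = begin
    G e (suc i)                 ≈⟨ gbin-over e<i+1 ⟩
    0#                          ≈⟨ sym (trans (+-identityˡ _) (gbin-over (ℕₚ.m<n⇒0<n∸m e<i+1))) ⟩
    0# + G 0 (suc i ∸ e)        ≈⟨ +-congˡ (reflexive (≡.sym (gbinSub-+ 0 e (suc i ∸ e)))) ⟩
    0# + Gₑ 0 (e ℕ.+ (suc i ∸ e)) ≈⟨ +-congˡ (reflexive (≡.cong (Gₑ 0) (ℕₚ.m+[n∸m]≡n (ℕₚ.<⇒≤ e<i+1)))) ⟩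
    0# + Gₑ 0 (suc i)           ∎
  gbin-+e (suc m) zero = sym (trans (+-congˡ (reflexive (gbinSub-< 0<e))) (+-identityʳ 1#))
  gbin-+e (suc m) (suc i) = begin
    G (m ℕ.+ e) i + x ^ suc i * G (m ℕ.+ e) (suc i)
      ≈⟨ +-cong (gbin-+e m i) (*-congˡ (gbin-+e m (suc i))) ⟩
    (G m i + Gₑ m i) + x ^ suc i * (G m (suc i) + Gₑ m (suc i))
      ≈⟨ solve 5 (λ a b c d y → (a :+ b) :+ y :* (c :+ d) := (a :+ y :* c) :+ (b :+ y :* d))
               ≈-refl (G m i) (Gₑ m i) (G m (suc i)) (Gₑ m (suc i)) (x ^ suc i) ⟩
    G (suc m) (suc i) + (Gₑ m i + x ^ suc i * Gₑ m (suc i))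
      ≈⟨ +-congˡ (trans (+-congˡ (x^-periodic m (suc i))) (gbinSub-pascal m i e)) ⟩
    G (suc m) (suc i) + Gₑ (suc m) (suc i) ∎

  q-lucas : ∀ a b {r t} → r < e → t < e → G (r ℕ.+ a ℕ.* e) (t ℕ.+ b ℕ.* e) ≈ ι R (a C b) * G r t
  q-lucas zero zero {r} {t} _ _ rewrite ℕₚ.+-identityʳ r | ℕₚ.+-identityʳ t =
    sym (trans (*-congʳ (+-identityʳ 1#)) (*-identityˡ _))
  q-lucas zero (suc b) {r} {t} r<e _ rewrite ℕₚ.+-identityʳ r =
    trans (gbin-over (ℕₚ.<-≤-trans r<e (ℕₚ.≤-trans (ℕₚ.m≤m+n e (b ℕ.* e)) (ℕₚ.m≤n+m _ t)))) (sym (zeroˡ _))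
  q-lucas (suc a) b {r} {t} r<e t<e = begin
    G (r ℕ.+ (e ℕ.+ a ℕ.* e)) (t ℕ.+ b ℕ.* e)   ≡⟨ ≡.cong (λ m → G m (t ℕ.+ b ℕ.* e)) (x+[y+z]≡x+z+y r e (a ℕ.* e)) ⟩
    G (M ℕ.+ e) (t ℕ.+ b ℕ.* e)                 ≈⟨ gbin-+e M (t ℕ.+ b ℕ.* e) ⟩
    G M (t ℕ.+ b ℕ.* e) + Gₑ M (t ℕ.+ b ℕ.* e)  ≈⟨ lower-digit-carry b ⟩
    ι R (suc a C b) * G r t                     ∎
    where
      M : ℕ
      M = r ℕ.+ a ℕ.* e
      lower-digit-carry : ∀ b → G M (t ℕ.+ b ℕ.* e) + Gₑ M (t ℕ.+ b ℕ.* e) ≈ ι R (suc a C b) * G r t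
      lower-digit-carry zero = begin
        G M (t ℕ.+ 0) + Gₑ M (t ℕ.+ 0)
          ≈⟨ +-cong (q-lucas a 0 r<e t<e) (reflexive (gbinSub-< (≡.subst (_< e) (≡.sym (ℕₚ.+-identityʳ t)) t<e))) ⟩
        ι R 1 * G r t + 0#              ≈⟨ +-identityʳ _ ⟩
        ι R 1 * G r t                   ∎
      lower-digit-carry (suc b) = begin
        G M (t ℕ.+ (e ℕ.+ b ℕ.* e)) + Gₑ M (t ℕ.+ (e ℕ.+ b ℕ.* e))
          ≡⟨ ≡.cong (G M (t ℕ.+ (e ℕ.+ b ℕ.* e)) +_)
                    (≡.trans (≡.cong (Gₑ M) (x+[y+z]≡y+[x+z] t e (b ℕ.* e))) (gbinSub-+ M e (t ℕ.+ b ℕ.* e))) ⟩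
        G M (t ℕ.+ (e ℕ.+ b ℕ.* e)) + G M (t ℕ.+ b ℕ.* e)
          ≈⟨ +-cong (q-lucas a (suc b) r<e t<e) (q-lucas a b r<e t<e) ⟩
        ι R (a C suc b) * G r t + ι R (a C b) * G r t
          ≈⟨ sym (distribʳ (G r t) _ _) ⟩
        (ι R (a C suc b) + ι R (a C b)) * G r t
          ≈⟨ *-congʳ (trans (+-comm _ _) (sym (×-homo-+ 1# (a C b) (a C suc b)))) ⟩
        ι R (a C b ℕ.+ a C suc b) * G r t
          ≡⟨ ≡.cong (λ n → ι R n * G r t) (nCk+nC[k+1]≡[n+1]C[k+1] a b) ⟩
        ι R (suc a C suc b) * G r t
          ∎

  q-lucas-≡ : ∀ a b {m i r t} → r < e → t < e → m ≡ r ℕ.+ a ℕ.* e → i ≡ t ℕ.+ b ℕ.* e →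
              G m i ≈ ι R (a C b) * G r t
  q-lucas-≡ a b r<e t<e refl refl = q-lucas a b r<e t<e

  q-lucas-≈0 : ∀ a b {m i r t} → r < t → t < e → m ≡ r ℕ.+ a ℕ.* e → i ≡ t ℕ.+ b ℕ.* e → G m i ≈ 0#
  q-lucas-≈0 a b r<t t<e m≡ i≡ =
    trans (q-lucas-≡ a b (ℕₚ.<-trans r<t t<e) t<e m≡ i≡) (trans (*-congˡ (gbin-over r<t)) (zeroʳ _))

  q-lucas-sub : ∀ a b {r j t} → r < e → suc j ℕ.+ t ≡ e →
                gbinSub R x (r ℕ.+ a ℕ.* e) (b ℕ.* e) (suc j) ≈ ι R (binomSub a b 1) * G r t
  q-lucas-sub a zero    _   _         = sym (zeroˡ _)
  q-lucas-sub a (suc b) {r} {j} {t} r<e 1+j+t≡e = begin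
    gbinSub R x M (e ℕ.+ b ℕ.* e) (suc j)            ≡⟨ ≡.cong (λ i → gbinSub R x M i (suc j)) e+be≡ ⟩
    gbinSub R x M (suc j ℕ.+ (t ℕ.+ b ℕ.* e)) (suc j) ≡⟨ gbinSub-+ M (suc j) (t ℕ.+ b ℕ.* e) ⟩
    G M (t ℕ.+ b ℕ.* e)                              ≈⟨ q-lucas a b r<e t<e ⟩
    ι R (a C b) * G r t                              ∎
    where
      M : ℕ
      M = r ℕ.+ a ℕ.* e
      e+be≡ : e ℕ.+ b ℕ.* e ≡ suc j ℕ.+ (t ℕ.+ b ℕ.* e)
      e+be≡ = ≡.trans (≡.cong (ℕ._+ b ℕ.* e) (≡.sym 1+j+t≡e)) (ℕₚ.+-assoc (suc j) t (b ℕ.* e))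
      t<e : t < e
      t<e = ≡.subst (t <_) 1+j+t≡e (s≤s (ℕₚ.m≤n+m t j))

-- Here e = f + 2, n = m + 2, and S≡ records s (n - 1) = (e - 1) + N e.
module FAtRoot {c ℓ : Level} (R : CommutativeRing c ℓ) (isField : IsFieldR R)
               (f : ℕ) (ω : CommutativeRing.Carrier R)
               (prim : PrimitiveRoot R (suc (suc f)) (CommutativeRing._*_ R ω ω))
               (s m N : ℕ) (S≡ : s ℕ.* suc m ≡ suc f ℕ.+ N ℕ.* suc (suc f)) where
  open CommutativeRing R renaming (refl to ≈-refl)
  open RS (Semiring.rawSemiring semiring) using (_^_)
  open import Relation.Binary.Reasoning.Setoid setoid
  open import Algebra.Solver.Ring.NaturalCoefficients.Default commutativeSemiring
  open import Algebra.Properties.Semiring.Mult semiring using (×-homo-+; ×1-homo-*)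

  private
    e n S : ℕ
    e = suc (suc f)
    n = suc (suc m)
    S = s ℕ.* suc m
    x : Carrier
    x = ω * ω
    G : ℕ → ℕ → Carrier
    G = gbin R x

  open GaussianBinomial R x using (gbin-over; gbin-diag)
  open QLucas R isField e x prim using (q-lucas-≡; q-lucas-≈0; q-lucas-sub)

  S+Ke≡ : ∀ K → S ℕ.+ K ℕ.* e ≡ suc f ℕ.+ (N ℕ.+ K) ℕ.* e
  S+Ke≡ K = ≡.trans (≡.cong (ℕ._+ K ℕ.* e) S≡)
                    (≡.trans (ℕₚ.+-assoc (suc f) (N ℕ.* e) (K ℕ.* e))
                             (≡.cong (suc f ℕ.+_) (≡.sym (ℕₚ.*-distribʳ-+ e N K))))

  gbin[m,Ke-1]≈0 : ∀ K {v u} → v ≤ f → m ≡ v ℕ.+ u ℕ.* e → gbinSub R x m (K ℕ.* e) 1 ≈ 0#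
  gbin[m,Ke-1]≈0 K {v} {u} v≤f m≡ = begin
    gbinSub R x m (K ℕ.* e) 1                ≡⟨ ≡.cong (λ i → gbinSub R x i (K ℕ.* e) 1) m≡ ⟩
    gbinSub R x (v ℕ.+ u ℕ.* e) (K ℕ.* e) 1  ≈⟨ q-lucas-sub u K (ℕₚ.m≤n⇒m≤1+n (s≤s v≤f)) refl ⟩
    ι R (binomSub u K 1) * G v (suc f)       ≈⟨ *-congˡ (gbin-over (s≤s v≤f)) ⟩
    ι R (binomSub u K 1) * 0#                ≈⟨ zeroʳ _ ⟩
    0#                                       ∎

  F-multiple : ∀ K {v u} → v ≤ f → m ≡ v ℕ.+ u ℕ.* e →
               F R s n (K ℕ.* e) ω ≈ ι R ((N ℕ.+ K) C K) * (ι R (u C K) + ι R (binomSub u K 1) * G v f * (1# + ω ^ n))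
  F-multiple K {v} {u} v≤f m≡ = begin
    A′ * G (suc m) k + A′ * gbinSub R x m k 1 * ω ^ n + A′ * gbinSub R x m k 2 + B′ * gbinSub R x m k 2 * ω ^ n
      ≈⟨ +-cong (+-cong (+-cong (*-cong A′≈ G₁≈) (*-congʳ (*-cong A′≈ (gbin[m,Ke-1]≈0 K {u = u} v≤f m≡))))
                        (*-cong A′≈ G₂≈))
                (*-congʳ (*-cong B′≈ G₂≈)) ⟩
    a * c₁ + a * 0# * ω ^ n + a * c₂ + a * c₂ * ω ^ n
      ≈⟨ solve 4 (λ a c₁ c₂ y → a :* c₁ :+ a :* con 0 :* y :+ a :* c₂ :+ a :* c₂ :* y := a :* (c₁ :+ c₂ :* (con 1 :+ y)))
               ≈-refl a c₁ c₂ (ω ^ n) ⟩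
    a * (c₁ + c₂ * (1# + ω ^ n)) ∎
    where
      k : ℕ
      k = K ℕ.* e
      A′ B′ a c₁ c₂ : Carrier
      A′ = G (S ℕ.+ k) k
      B′ = G (S ℕ.+ k ∸ 1) k
      a = ι R ((N ℕ.+ K) C K)
      c₁ = ι R (u C K)
      c₂ = ι R (binomSub u K 1) * G v f
      A′≈ : A′ ≈ a
      A′≈ = trans (q-lucas-≡ (N ℕ.+ K) K ℕₚ.≤-refl (s≤s z≤n) (S+Ke≡ K) refl) (*-identityʳ a)
      B′≈ : B′ ≈ a
      B′≈ = trans (q-lucas-≡ (N ℕ.+ K) K (ℕₚ.m≤n⇒m≤1+n ℕₚ.≤-refl) (s≤s z≤n) (≡.cong (_∸ 1) (S+Ke≡ K)) refl)
                  (*-identityʳ a)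
      G₁≈ : G (suc m) k ≈ c₁
      G₁≈ = trans (q-lucas-≡ u K (s≤s (s≤s v≤f)) (s≤s z≤n) (≡.cong suc m≡) refl) (*-identityʳ c₁)
      G₂≈ : gbinSub R x m k 2 ≈ c₂
      G₂≈ = trans (reflexive (≡.cong (λ i → gbinSub R x i k 2) m≡)) (q-lucas-sub u K (ℕₚ.m≤n⇒m≤1+n (s≤s v≤f)) refl)

  F-nonmultiple : ∀ t K → suc t < e → F R s n (suc t ℕ.+ K ℕ.* e) ω ≈ 0#
  F-nonmultiple t K t+1<e = begin
    A′ * G (suc m) k + A′ * gbinSub R x m k 1 * ω ^ n + A′ * gbinSub R x m k 2 + B′ * gbinSub R x m k 2 * ω ^ n
      ≈⟨ +-cong (+-cong (+-cong (*-congʳ A′≈0) (*-congʳ (*-congʳ A′≈0))) (*-congʳ A′≈0))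
                (*-congʳ (B′G₂≈0 t t+1<e)) ⟩
    0# * G (suc m) k + 0# * gbinSub R x m k 1 * ω ^ n + 0# * gbinSub R x m k 2 + 0# * ω ^ n
      ≈⟨ solve 4 (λ a b c y → con 0 :* a :+ con 0 :* b :* y :+ con 0 :* c :+ con 0 :* y := con 0)
               ≈-refl (G (suc m) k) (gbinSub R x m k 1) (gbinSub R x m k 2) (ω ^ n) ⟩
    0# ∎
    where
      k : ℕ
      k = suc t ℕ.+ K ℕ.* e
      A′ B′ : Carrier
      A′ = G (S ℕ.+ k) k
      B′ = G (S ℕ.+ k ∸ 1) k
      S+k≡ : ∀ t → S ℕ.+ (suc t ℕ.+ K ℕ.* e) ≡ t ℕ.+ suc (N ℕ.+ K) ℕ.* e
      S+k≡ t = ≡.trans (≡.cong (ℕ._+ (suc t ℕ.+ K ℕ.* e)) S≡) (S+k≡t+[N+K+1]e f N t K)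
      A′≈0 : A′ ≈ 0#
      A′≈0 = q-lucas-≈0 (suc (N ℕ.+ K)) K (ℕₚ.n<1+n t) t+1<e (S+k≡ t) refl
      B′G₂≈0 : ∀ t → suc t < e →
               G (S ℕ.+ (suc t ℕ.+ K ℕ.* e) ∸ 1) (suc t ℕ.+ K ℕ.* e) * gbinSub R x m (suc t ℕ.+ K ℕ.* e) 2 ≈ 0#
      B′G₂≈0 zero _ with last-digit≤ {s = s} {N = N} S≡
      ... | _ , u , v≤f , m≡ = trans (*-congˡ (gbin[m,Ke-1]≈0 K {u = u} v≤f m≡)) (zeroʳ _)
      B′G₂≈0 (suc t) t+2<e =
        trans (*-congʳ (q-lucas-≈0 (suc (N ℕ.+ K)) K (ℕₚ.m<n⇒m<1+n (ℕₚ.n<1+n t)) t+2<e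
                                   (≡.cong (_∸ 1) (S+k≡ (suc t))) refl))
              (zeroˡ _)

  F-e∤k : ∀ k → ¬ e ∣ k → F R s n k ω ≈ 0#
  F-e∤k k e∤k with k divMod e
  ... | result K zero    refl = contradiction (divides K refl) e∤k
  ... | result K (suc t) refl = F-nonmultiple (toℕ t) K (toℕ<n (suc t))

  private
    ι*[ι+z]≈ι[*] : ∀ A c {z} → z ≈ 0# → ι R A * (ι R c + z) ≈ ι R (A ℕ.* c)
    ι*[ι+z]≈ι[*] A c z≈0 = trans (*-congˡ (trans (+-congˡ z≈0) (+-identityʳ _))) (sym (×1-homo-* A c))

  F-e∣n-ω^n≈1 : ∀ K u → m ≡ f ℕ.+ u ℕ.* e → ω ^ n ≈ 1# →
                F R s n (K ℕ.* e) ω ≈ ι R (((N ℕ.+ K) C K) ℕ.* (suc u C K ℕ.+ binomSub u K 1))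
  F-e∣n-ω^n≈1 K u m≡ ωⁿ≈1 = begin
    F R s n (K ℕ.* e) ω
      ≈⟨ F-multiple K ℕₚ.≤-refl m≡ ⟩
    a * (c₀ + b * G f f * (1# + ω ^ n))
      ≈⟨ *-congˡ (+-congˡ (*-cong (trans (*-congˡ (gbin-diag f)) (*-identityʳ b)) (+-congˡ ωⁿ≈1))) ⟩
    a * (c₀ + b * (1# + 1#))
      ≈⟨ solve 3 (λ a b c₀ → a :* (c₀ :+ b :* (con 1 :+ con 1)) := a :* ((c₀ :+ b) :+ b)) ≈-refl a b c₀ ⟩
    a * ((c₀ + b) + b)
      ≈⟨ *-congˡ (sym (trans (×-homo-+ 1# (u C K ℕ.+ binomSub u K 1) _) (+-congʳ (×-homo-+ 1# (u C K) _)))) ⟩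
    a * ι R ((u C K ℕ.+ binomSub u K 1) ℕ.+ binomSub u K 1)
      ≡⟨ ≡.cong (λ j → a * ι R (j ℕ.+ binomSub u K 1)) (≡.sym (suc-C≡C+binomSub u K)) ⟩
    a * ι R (suc u C K ℕ.+ binomSub u K 1)
      ≈⟨ sym (×1-homo-* ((N ℕ.+ K) C K) _) ⟩
    ι R (((N ℕ.+ K) C K) ℕ.* (suc u C K ℕ.+ binomSub u K 1)) ∎
    where
      a b c₀ : Carrier
      a = ι R ((N ℕ.+ K) C K)
      b = ι R (binomSub u K 1)
      c₀ = ι R (u C K)

  F-e∣n-ω^n≈-1 : ∀ K u → m ≡ f ℕ.+ u ℕ.* e → 1# + ω ^ n ≈ 0# →
                 F R s n (K ℕ.* e) ω ≈ ι R (((N ℕ.+ K) C K) ℕ.* (u C K))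
  F-e∣n-ω^n≈-1 K u m≡ 1+ωⁿ≈0 =
    trans (F-multiple K ℕₚ.≤-refl m≡) (ι*[ι+z]≈ι[*] ((N ℕ.+ K) C K) (u C K) (trans (*-congˡ 1+ωⁿ≈0) (zeroʳ _)))

  F-e∤n : ∀ K {v u} → v < f → m ≡ v ℕ.+ u ℕ.* e → F R s n (K ℕ.* e) ω ≈ ι R (((N ℕ.+ K) C K) ℕ.* (u C K))
  F-e∤n K v<f m≡ =
    trans (F-multiple K (ℕₚ.<⇒≤ v<f) m≡)
          (ι*[ι+z]≈ι[*] ((N ℕ.+ K) C K) _ (trans (*-congʳ (trans (*-congˡ (gbin-over v<f)) (zeroʳ _))) (zeroˡ _)))

open import Data.Nat using (_+_; _*_)

Conclusion : ∀ {c ℓ : Level} (R : CommutativeRing c ℓ) (s n k d : ℕ) .{{_ : NonZero d}} →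
             CommutativeRing.Carrier R → Set ℓ
Conclusion R s n k d ω =
    let _≈_ = CommutativeRing._≈_ R
        Fω = F R s n k ω
        A₁ = ((s * (n ∸ 1) + 1 + k) / d ∸ 1) C (k / d)
        A₂ = ((2 * s * (n ∸ 1) + 2 + 2 * k) / d ∸ 1) C ((2 * k) / d)
    in ((¬ (2 ∣ d) → d ∣ k → d ∣ n →
          Fω ≈ ι R (A₁ * ((n / d) C (k / d) + binomSub ((n / d) ∸ 1) (k / d) 1)))
      × (¬ (2 ∣ d) → d ∣ k → ¬ (d ∣ n) →
          Fω ≈ ι R (A₁ * (((n ∸ 2) / d) C (k / d))))
      × (2 ∣ d → d ∣ (2 * k) → d ∣ n →
          Fω ≈ ι R (A₂ * (((2 * n) / d) C ((2 * k) / d) + binomSub (((2 * n) / d) ∸ 1) ((2 * k) / d) 1)))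
      × (2 ∣ d → d ∣ (2 * k) → ¬ (d ∣ n) →
          Fω ≈ ι R (A₂ * (((2 * (n ∸ 2)) / d) C ((2 * k) / d))))
      × (¬ (¬ (2 ∣ d) × d ∣ k) → ¬ (2 ∣ d × d ∣ (2 * k)) →
          Fω ≈ CommutativeRing.0# R))

module OddOrder {c ℓ : Level} (R : CommutativeRing c ℓ) (isField : IsFieldR R)
                (f : ℕ) (ω : CommutativeRing.Carrier R) (d-odd : ¬ 2 ∣ suc (suc f)) (prim : PrimitiveRoot R (suc (suc f)) ω)
                (s m N : ℕ) (S≡ : s * suc m ≡ suc f + N * suc (suc f)) where
  open CommutativeRing R using (_≈_)
  open PrimitiveRoots R using (square-primitive-odd; ∣⇒^≈1)
  open FAtRoot R isField f ω (square-primitive-odd d-odd prim) s m N S≡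

  private
    e n : ℕ
    e = suc (suc f)
    n = suc (suc m)

  [S+1+Ke]/e≡N+K+1 : ∀ K → (s * suc m + 1 + K * e) / e ≡ suc (N + K)
  [S+1+Ke]/e≡N+K+1 K = ≡.trans (≡.cong (λ S → (S + 1 + K * e) / e) S≡)
                               (≡.trans (≡.cong (_/ e) (S+1+Ke≡[N+K+1]e f N K)) (m*n/n≡m (suc (N + K)) e))

  Ke/e≡K : ∀ K → K * e / e ≡ K
  Ke/e≡K K = m*n/n≡m K e

  m≡v+ue⇒m/e≡u : ∀ {v u} → v < e → m ≡ v + u * e → m / e ≡ u
  m≡v+ue⇒m/e≡u {u = u} v<e m≡ = ≡.trans (≡.cong (_/ e) m≡) ([r+q*e]/e≡q u v<e)

  m≡f+ue⇒n/e≡u+1 : ∀ {u} → m ≡ f + u * e → n / e ≡ suc u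
  m≡f+ue⇒n/e≡u+1 {u} m≡ = ≡.trans (≡.cong (λ j → suc (suc j) / e) m≡) (m*n/n≡m (suc u) e)

  F-e∣k-e∣n : ∀ k → e ∣ k → e ∣ n →
              F R s n k ω ≈ ι R ((((s * suc m + 1 + k) / e ∸ 1) C (k / e))
                                 * ((n / e) C (k / e) + binomSub ((n / e) ∸ 1) (k / e) 1))
  F-e∣k-e∣n _ (divides K refl) e∣n with ∣2+m⇒last-digit e∣n
  ... | u , m≡ rewrite [S+1+Ke]/e≡N+K+1 K | Ke/e≡K K | m≡f+ue⇒n/e≡u+1 m≡
    = F-e∣n-ω^n≈1 K u m≡ (∣⇒^≈1 prim e∣n)

  F-e∣k-e∤n : ∀ k → e ∣ k → ¬ e ∣ n →
              F R s n k ω ≈ ι R ((((s * suc m + 1 + k) / e ∸ 1) C (k / e)) * ((m / e) C (k / e)))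
  F-e∣k-e∤n _ (divides K refl) e∤n with last-digit≤ {s = s} {N = N} S≡
  ... | v , u , v≤f , m≡ with ℕₚ.m≤n⇒m<n∨m≡n v≤f
  ...   | inj₂ refl = contradiction (divides (suc u) (≡.cong (λ j → suc (suc j)) m≡)) e∤n
  ...   | inj₁ v<f rewrite [S+1+Ke]/e≡N+K+1 K | Ke/e≡K K
                         | m≡v+ue⇒m/e≡u {u = u} (ℕₚ.m<n⇒m<1+n (ℕₚ.m<n⇒m<1+n v<f)) m≡
    = F-e∤n K v<f m≡

  conclusion : ∀ k → Conclusion R s n k e ω
  conclusion k = (λ _ → F-e∣k-e∣n k)
               , (λ _ → F-e∣k-e∤n k)
               , (λ 2∣e → contradiction 2∣e d-odd)
               , (λ 2∣e → contradiction 2∣e d-odd)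
               , (λ ¬[odd×e∣k] _ → F-e∤k k (λ e∣k → ¬[odd×e∣k] (d-odd , e∣k)))

module EvenOrder {c ℓ : Level} (R : CommutativeRing c ℓ) (isField : IsFieldR R)
                 (f : ℕ) (ω : CommutativeRing.Carrier R) (prim : PrimitiveRoot R (suc (suc f) * 2) ω)
                 (s m N : ℕ) (S≡ : s * suc m ≡ suc f + N * suc (suc f)) where
  open CommutativeRing R using (_≈_)
  open PrimitiveRoots R using (square-primitive-even; ∣⇒^≈1)
  open Field R isField using (half-order-power≈-1)
  open FAtRoot R isField f ω (square-primitive-even prim) s m N S≡

  private
    e d n : ℕ
    e = suc (suc f)
    d = e * 2
    n = suc (suc m)

  2∣d : 2 ∣ d
  2∣d = divides e refl

  e∣d : e ∣ d
  e∣d = divides 2 (ℕₚ.*-comm e 2)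

  d∣2k⇒e∣k : ∀ {k} → d ∣ 2 * k → e ∣ k
  d∣2k⇒e∣k {k} d∣2k = *-cancelʳ-∣ 2 (≡.subst (d ∣_) (ℕₚ.*-comm 2 k) d∣2k)

  e∣k⇒d∣2k : ∀ {k} → e ∣ k → d ∣ 2 * k
  e∣k⇒d∣2k (divides K refl) = divides K (2[Ke]≡K[e2] K e)

  [2S+2+2Ke]/d≡N+K+1 : ∀ K → (2 * s * suc m + 2 + 2 * (K * e)) / d ≡ suc (N + K)
  [2S+2+2Ke]/d≡N+K+1 K = ≡.trans (≡.cong (λ S → (S + 2 + 2 * (K * e)) / d)
                                          (≡.trans (ℕₚ.*-assoc 2 s (suc m)) (≡.cong (2 *_) S≡)))
                                 (≡.trans (≡.cong (_/ d) (2S+2+2Ke≡[N+K+1][2e] f N K)) (m*n/n≡m (suc (N + K)) d))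

  2Ke/d≡K : ∀ K → (2 * (K * e)) / d ≡ K
  2Ke/d≡K K = ≡.trans (≡.cong (_/ d) (2[Ke]≡K[e2] K e)) (m*n/n≡m K d)

  m≡f+ue⇒2n/d≡u+1 : ∀ {u} → m ≡ f + u * e → (2 * n) / d ≡ suc u
  m≡f+ue⇒2n/d≡u+1 {u} m≡ = ≡.trans (≡.cong (λ j → (2 * suc (suc j)) / d) m≡) (2Ke/d≡K (suc u))

  m≡v+ue⇒2m/d≡u : ∀ {v u} → v < e → m ≡ v + u * e → (2 * m) / d ≡ u
  m≡v+ue⇒2m/d≡u {u = u} v<e m≡ = ≡.trans (≡.cong (λ j → (2 * j) / d) m≡) ([2[v+ue]]/[e2]≡u u v<e)

  F-e∣k-d∣n : ∀ k → d ∣ 2 * k → d ∣ n →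
              F R s n k ω ≈ ι R ((((2 * s * suc m + 2 + 2 * k) / d ∸ 1) C ((2 * k) / d))
                                 * (((2 * n) / d) C ((2 * k) / d) + binomSub (((2 * n) / d) ∸ 1) ((2 * k) / d) 1))
  F-e∣k-d∣n k d∣2k d∣n with d∣2k⇒e∣k {k} d∣2k | ∣2+m⇒last-digit (∣-trans e∣d d∣n)
  ... | divides K refl | u , m≡ rewrite [2S+2+2Ke]/d≡N+K+1 K | 2Ke/d≡K K | m≡f+ue⇒2n/d≡u+1 m≡
    = F-e∣n-ω^n≈1 K u m≡ (∣⇒^≈1 prim d∣n)

  F-e∣k-d∤n : ∀ k → d ∣ 2 * k → ¬ d ∣ n →
              F R s n k ω ≈ ι R ((((2 * s * suc m + 2 + 2 * k) / d ∸ 1) C ((2 * k) / d)) * (((2 * m) / d) C ((2 * k) / d)))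
  F-e∣k-d∤n k d∣2k d∤n with d∣2k⇒e∣k {k} d∣2k | last-digit≤ {s = s} {N = N} S≡
  ... | divides K refl | v , u , v≤f , m≡
    rewrite [2S+2+2Ke]/d≡N+K+1 K | 2Ke/d≡K K | m≡v+ue⇒2m/d≡u {u = u} (ℕₚ.m≤n⇒m≤1+n (s≤s v≤f)) m≡
    with ℕₚ.m≤n⇒m<n∨m≡n v≤f
  ... | inj₁ v<f = F-e∤n K v<f m≡
  ... | inj₂ refl =
    F-e∣n-ω^n≈-1 K u m≡ (half-order-power≈-1 prim (divides (suc u) (≡.cong (λ j → suc (suc j)) m≡)) d∤n)

  conclusion : ∀ k → Conclusion R s n k d ω
  conclusion k = (λ ¬2∣d → contradiction 2∣d ¬2∣d)
               , (λ ¬2∣d → contradiction 2∣d ¬2∣d)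
               , (λ _ → F-e∣k-d∣n k)
               , (λ _ → F-e∣k-d∤n k)
               , (λ _ ¬[even×d∣2k] → F-e∤k k (λ e∣k → ¬[even×d∣2k] (2∣d , e∣k⇒d∣2k e∣k)))

data ParityView : ℕ → Set where
  odd  : ∀ f → ¬ 2 ∣ suc (suc f) → ParityView (suc (suc f))
  even : ∀ f → ParityView (suc (suc f) * 2)

parity-view : ∀ d → 3 ≤ d → ParityView d
parity-view (suc zero)       (s≤s ())
parity-view (suc (suc zero)) (s≤s (s≤s ()))
parity-view (suc (suc (suc d))) _ with 2 ∣? suc (suc (suc d))
... | no d-odd                        = odd (suc d) d-odd
... | yes (divides (suc (suc f)) d≡) = ≡.subst ParityView (≡.sym d≡) (even f)

proposition5p4 : ∀ {c ℓ : Level} (R : CommutativeRing c ℓ) → IsFieldR R → CharZero R →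
    ∀ (s n k d : ℕ) .{{_ : NonZero d}} (ω : CommutativeRing.Carrier R) →
    1 ≤ s → 2 ≤ n → k ≤ n → 3 ≤ d → d ∣ (2 * s * (n ∸ 1) + 2) → PrimitiveRoot R d ω →
    let _≈_ = CommutativeRing._≈_ R
        Fω = F R s n k ω
        A₁ = ((s * (n ∸ 1) + 1 + k) / d ∸ 1) C (k / d)
        A₂ = ((2 * s * (n ∸ 1) + 2 + 2 * k) / d ∸ 1) C ((2 * k) / d)
    in ((¬ (2 ∣ d) → d ∣ k → d ∣ n →
          Fω ≈ ι R (A₁ * ((n / d) C (k / d) + binomSub ((n / d) ∸ 1) (k / d) 1)))
      × (¬ (2 ∣ d) → d ∣ k → ¬ (d ∣ n) →
          Fω ≈ ι R (A₁ * (((n ∸ 2) / d) C (k / d))))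
      × (2 ∣ d → d ∣ (2 * k) → d ∣ n →
          Fω ≈ ι R (A₂ * (((2 * n) / d) C ((2 * k) / d) + binomSub (((2 * n) / d) ∸ 1) ((2 * k) / d) 1)))
      × (2 ∣ d → d ∣ (2 * k) → ¬ (d ∣ n) →
          Fω ≈ ι R (A₂ * (((2 * (n ∸ 2)) / d) C ((2 * k) / d))))
      × (¬ (¬ (2 ∣ d) × d ∣ k) → ¬ (2 ∣ d × d ∣ (2 * k)) →
          Fω ≈ CommutativeRing.0# R))
proposition5p4 R isField _ s (suc (suc m)) k d ω _ (s≤s (s≤s _)) _ 3≤d d∣2S+2 prim with parity-view d 3≤d
... | odd f d-odd with ∣S+1⇒S≡ (odd∣2[S+1]⇒∣S+1 {s = s} {m = suc m} d-odd d∣2S+2)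
...   | N , S≡ = OddOrder.conclusion R isField f ω d-odd prim s m N S≡ k
proposition5p4 R isField _ s (suc (suc m)) k _ ω _ _ _ _ d∣2S+2 prim | even f
  with ∣S+1⇒S≡ (2e∣2[S+1]⇒e∣S+1 {s = s} {m = suc m} d∣2S+2)
... | N , S≡ = EvenOrder.conclusion R isField f ω prim s m N S≡ k
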